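{- For every $N$-tableau $T$ on $A$ and every letter $x\in A$, the $N$-insertion of $x$ into $T$ produces an $N$-tableau.
   Context: $A$ is a finite totally ordered alphabet. Tableaux are in French convention (rows numbered from the bottom, entries weakly increasing in rows left to right and strictly increasing in columns bottom to top). An $N$-tableau is a tableau whose rows are strictly increasing and in which each row, viewed as a subset of $A$, is contained in the row below. $N$-insertion of $x$ into a strictly increasing row $B$ yields the row $B\cup\{x\}$, and if there is a smallest element $y$ of $B$ strictly larger than $x$, a copy of $y$ is bumped (otherwise nothing is bumped). $N$-insertion of $x$ into an $N$-tableau: insert $x$ into the first row; if a letter is bumped, $N$-insert it into the second row (a new empty row if needed), and so on until nothing is bumped. -}

module Defs where

open import Data.Nat using (ℕ)
open import Data.Fin using (Fin; _<_; _≤_; _<?_; _≟_)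
open import Data.List using (List; []; _∷_; length)
open import Data.List.Relation.Unary.All using (All)
open import Data.List.Relation.Unary.Linked using (Linked)
open import Data.List.Relation.Binary.Subset.Propositional using (_⊆_)
open import Data.Maybe using (Maybe; just; nothing)
open import Data.Product using (_×_)
open import Relation.Nullary using (yes; no; ¬_)

-- The alphabet: a finite totally ordered set, taken to be Fin n with its usual order
-- (every finite total order is isomorphic to one of these).
Letter : ℕ → Set
Letter n = Fin n

Row : ℕ → Set
Row n = List (Letter n)

-- A tableau is a list of rows, the head being the bottom row (row 1, French convention).
Tab : ℕ → Set
Tab n = List (Row n)

data Below {n : ℕ} : Row n → Row n → Set where
  below-[] : ∀ {lower} → Below lower []
  below-∷  : ∀ {l u ls us} → l < u → Below ls us → Below (l ∷ ls) (u ∷ us)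

NonEmpty : {n : ℕ} → Row n → Set
NonEmpty [] = Data.Empty.⊥ where import Data.Empty
NonEmpty (_ ∷ _) = Data.Unit.⊤ where import Data.Unit

IsTableau : {n : ℕ} → Tab n → Set
IsTableau T = All NonEmpty T × All (Linked _≤_) T × Linked Below T

IsNTableau : {n : ℕ} → Tab n → Set
IsNTableau T = IsTableau T × All (Linked _<_) T × Linked (λ lower upper → upper ⊆ lower) T

rowUnion : {n : ℕ} → Letter n → Row n → Row n
rowUnion x [] = x ∷ []
rowUnion x (b ∷ bs) with x <? b
... | yes _ = x ∷ b ∷ bs
... | no _ with x ≟ b
...   | yes _ = b ∷ bs
...   | no _  = b ∷ rowUnion x bs

minOpt : {n : ℕ} → Letter n → Maybe (Letter n) → Letter n
minOpt b nothing = b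
minOpt b (just c) with c <? b
... | yes _ = c
... | no _  = b

bumped : {n : ℕ} → Letter n → Row n → Maybe (Letter n)
bumped x [] = nothing
bumped x (b ∷ bs) with x <? b
... | yes _ = just (minOpt b (bumped x bs))
... | no _  = bumped x bs

NInsert : {n : ℕ} → Letter n → Tab n → Tab n
NInsert x [] = (x ∷ []) ∷ []
NInsert x (r ∷ rs) with bumped x r
... | nothing = rowUnion x r ∷ rs
... | just y  = rowUnion x r ∷ NInsert y rs

-- For strictly increasing rows L (below) and U (above), the column condition
-- together with U ⊆ L says exactly that U avoids the least letter of L: the
-- i-th letter of U then sits in L at a position beyond i. Phrased as
-- "every letter of U lies in L and exceeds some letter of L", the N-tableau
-- condition mentions membership only, and N-insertion visibly preserves it:
-- the lower row gains x, the row above gains the bumped letter y, and y is a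
-- letter of the lower row exceeding x.
module Submission where

open import Data.Nat using (ℕ)
import Data.Nat.Properties as ℕ
open import Data.Fin using (_≤_; _<_; _<?_; _≟_)
import Data.Fin.Properties as F
open import Data.List using ([]; _∷_)
import Data.List as List
open import Data.List.Membership.Propositional using (_∈_; find; lose)
open import Data.List.Relation.Binary.Subset.Propositional using (_⊆_)
open import Data.List.Relation.Binary.Subset.Propositional.Properties using (Any-resp-⊆)
open import Data.List.Relation.Unary.All as All using (All; []; _∷_)
open import Data.List.Relation.Unary.Any using (Any; here; there)
open import Data.List.Relation.Unary.Linked as Linked using (Linked; []; [-]; _∷_; _∷′_)
open import Data.List.Relation.Unary.Linked.Properties using (Linked⇒All)
open import Data.Maybe using (just; nothing)
open import Data.Maybe.Relation.Binary.Connected using (Connected; just; just-nothing)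
open import Data.Product using (_×_; _,_; proj₁; map₁)
open import Data.Sum using (_⊎_; inj₁; inj₂)
open import Data.Unit using (tt)
open import Function using (_∘_)
open import Relation.Nullary using (yes; no; ¬_; contradiction)
open import Relation.Binary.PropositionalEquality using (_≡_; refl; sym; subst)

open import Defs

module _ {n : ℕ} where

  Sorted : Row n → Set
  Sorted = Linked _<_

  ≮∧≢⇒> : ∀ {x b : Letter n} → ¬ x < b → ¬ x ≡ b → b < x
  ≮∧≢⇒> x≮b x≢b = F.≤∧≢⇒< (ℕ.≮⇒≥ x≮b) (x≢b ∘ sym)

  sorted-head-< : ∀ {l : Letter n} {ls} → Sorted (l ∷ ls) → All (l <_) ls
  sorted-head-< [-]         = []
  sorted-head-< (l<l′ ∷ s) = Linked⇒All F.<-trans l<l′ s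

  sorted-head-≤ : ∀ {l z : Letter n} {ls} → Sorted (l ∷ ls) → z ∈ l ∷ ls → l ≤ z
  sorted-head-≤ _ (here refl)   = F.≤-refl
  sorted-head-≤ s (there z∈ls) = ℕ.<⇒≤ (All.lookup (sorted-head-< s) z∈ls)

  ∷-sorted : ∀ {b : Letter n} {bs} → All (b <_) bs → Sorted bs → Sorted (b ∷ bs)
  ∷-sorted []          _ = [-]
  ∷-sorted (b<c ∷ _) s = b<c ∷ s

  ∈-∷-drop : ∀ {z l : Letter n} {ls} → z ∈ l ∷ ls → l < z → z ∈ ls
  ∈-∷-drop (here refl) l<z = contradiction l<z (F.<-irrefl refl)
  ∈-∷-drop (there z∈ls) _  = z∈ls

  ∈-rowUnion⁺ˡ : ∀ {x : Letter n} L → x ∈ rowUnion x L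
  ∈-rowUnion⁺ˡ []        = here refl
  ∈-rowUnion⁺ˡ {x} (b ∷ bs) with x <? b
  ... | yes _ = here refl
  ... | no _ with x ≟ b
  ...   | yes x≡b = here x≡b
  ...   | no _    = there (∈-rowUnion⁺ˡ bs)

  ∈-rowUnion⁺ʳ : ∀ {x z : Letter n} L → z ∈ L → z ∈ rowUnion x L
  ∈-rowUnion⁺ʳ {x} (b ∷ bs) z∈L with x <? b
  ... | yes _ = there z∈L
  ... | no _ with x ≟ b | z∈L
  ...   | yes _ | _           = z∈L
  ...   | no _  | here z≡b    = here z≡b
  ...   | no _  | there z∈bs = there (∈-rowUnion⁺ʳ bs z∈bs)

  ∈-rowUnion⁻ : ∀ {x z : Letter n} L → z ∈ rowUnion x L → z ≡ x ⊎ z ∈ L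
  ∈-rowUnion⁻ [] (here z≡x) = inj₁ z≡x
  ∈-rowUnion⁻ {x} (b ∷ bs) z∈ with x <? b
  ∈-rowUnion⁻ _ (here z≡x)  | yes _ = inj₁ z≡x
  ∈-rowUnion⁻ _ (there z∈L) | yes _ = inj₂ z∈L
  ∈-rowUnion⁻ {x} (b ∷ bs) z∈ | no _ with x ≟ b
  ... | yes _ = inj₂ z∈
  ∈-rowUnion⁻ _ (here z≡b) | no _ | no _ = inj₂ (here z≡b)
  ∈-rowUnion⁻ (_ ∷ bs) (there z∈) | no _ | no _ with ∈-rowUnion⁻ bs z∈
  ... | inj₁ z≡x  = inj₁ z≡x
  ... | inj₂ z∈bs = inj₂ (there z∈bs)

  All-rowUnion⁺ : ∀ {P : Letter n → Set} {x} L → P x → All P L → All P (rowUnion x L)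
  All-rowUnion⁺ {P} {x} L px pL = All.tabulate (P-∈ ∘ ∈-rowUnion⁻ L)
    where
      P-∈ : ∀ {z} → z ≡ x ⊎ z ∈ L → P z
      P-∈ (inj₁ refl) = px
      P-∈ (inj₂ z∈L)  = All.lookup pL z∈L

  rowUnion-sorted : ∀ {x : Letter n} L → Sorted L → Sorted (rowUnion x L)
  rowUnion-sorted [] _ = [-]
  rowUnion-sorted {x} (b ∷ bs) s with x <? b
  ... | yes x<b = x<b ∷ s
  ... | no x≮b with x ≟ b
  ...   | yes _   = s
  ...   | no x≢b =
    ∷-sorted (All-rowUnion⁺ bs (≮∧≢⇒> x≮b x≢b) (sorted-head-< s))
             (rowUnion-sorted bs (Linked.tail s))

  rowUnion-nonEmpty : ∀ {x : Letter n} L → NonEmpty (rowUnion x L)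
  rowUnion-nonEmpty [] = tt
  rowUnion-nonEmpty {x} (b ∷ bs) with x <? b
  ... | yes _ = tt
  ... | no _ with x ≟ b
  ...   | yes _ = tt
  ...   | no _  = tt

  minOpt-choice : ∀ (b : Letter n) m → minOpt b m ≡ b ⊎ m ≡ just (minOpt b m)
  minOpt-choice b nothing = inj₁ refl
  minOpt-choice b (just c) with c <? b
  ... | yes _ = inj₂ refl
  ... | no _  = inj₁ refl

  bumped-∈-> : ∀ {x y : Letter n} L → bumped x L ≡ just y → y ∈ L × x < y
  bumped-∈-> {x} (b ∷ bs) eq with x <? b | eq
  ... | no _    | eq′  = map₁ there (bumped-∈-> bs eq′)
  ... | yes x<b | refl with minOpt-choice b (bumped x bs)
  ...   | inj₁ y≡b = here y≡b , subst (x <_) (sym y≡b) x<b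
  ...   | inj₂ eq′ = map₁ there (bumped-∈-> bs eq′)

  -- For strictly increasing rows, equivalent to Below lower upper × upper ⊆ lower.
  Covers : Row n → Row n → Set
  Covers lower upper = ∀ {u} → u ∈ upper → u ∈ lower × Any (_< u) lower

  covers⇒⊆ : ∀ {L U : Row n} → Covers L U → U ⊆ L
  covers⇒⊆ cov u∈U = proj₁ (cov u∈U)

  covers-rowUnion : ∀ {x : Letter n} {L U} → Covers L U → Covers (rowUnion x L) U
  covers-rowUnion {L = L} cov u∈U with cov u∈U
  ... | u∈L , ∃l<u = ∈-rowUnion⁺ʳ L u∈L , Any-resp-⊆ (∈-rowUnion⁺ʳ L) ∃l<u

  covers-bumped : ∀ {x y : Letter n} {L U} → Covers L U → bumped x L ≡ just y →
                  Covers (rowUnion x L) (rowUnion y U)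
  covers-bumped {x} {y} {L} {U} cov eq u∈ with ∈-rowUnion⁻ U u∈ | bumped-∈-> L eq
  ... | inj₁ refl | y∈L , x<y = ∈-rowUnion⁺ʳ L y∈L , lose (∈-rowUnion⁺ˡ L) x<y
  ... | inj₂ u∈U  | _         = covers-rowUnion cov u∈U

  below⇒covers : ∀ {L U : Row n} → Sorted U → Below L U → U ⊆ L → Covers L U
  below⇒covers sU below-[] _ ()
  below⇒covers sU (below-∷ l<u _) U⊆L u∈U =
    U⊆L u∈U , here (All.lookup (Linked⇒All F.<-trans l<u sU) u∈U)

  ⊆-tail⇒below : ∀ {l : Letter n} {ls U} → Sorted (l ∷ ls) → Sorted U → U ⊆ ls →
                 Below (l ∷ ls) U
  ⊆-tail⇒below {U = []} _ _ _ = below-[]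
  ⊆-tail⇒below {ls = []} {_ ∷ _} _ _ U⊆[] with U⊆[] (here refl)
  ... | ()
  ⊆-tail⇒below {ls = _ ∷ ls} {_ ∷ us} sL sU U⊆ls =
    below-∷ (All.lookup (sorted-head-< sL) (U⊆ls (here refl)))
            (⊆-tail⇒below (Linked.tail sL) (Linked.tail sU) us⊆ls)
    where
      us⊆ls : us ⊆ ls
      us⊆ls v∈us = ∈-∷-drop (U⊆ls (there v∈us))
                     (ℕ.≤-<-trans (sorted-head-≤ (Linked.tail sL) (U⊆ls (here refl)))
                                  (All.lookup (sorted-head-< sU) v∈us))

  covers⇒below : ∀ {L U : Row n} → Sorted L → Sorted U → Covers L U → Below L U
  covers⇒below {[]} {[]}    _ _ _   = below-[]
  covers⇒below {[]} {_ ∷ _} _ _ cov with proj₁ (cov (here refl))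
  ... | ()
  covers⇒below {l ∷ ls} sL sU cov = ⊆-tail⇒below sL sU U⊆ls
    where
      U⊆ls : _ ⊆ ls
      U⊆ls u∈U with cov u∈U
      ... | u∈L , ∃l′<u with find ∃l′<u
      ...   | _ , l′∈L , l′<u =
        ∈-∷-drop u∈L (ℕ.≤-<-trans (sorted-head-≤ sL l′∈L) l′<u)

  linked-mapWithAll : ∀ {P : Row n → Set} {R S : Row n → Row n → Set} →
                      (∀ {a b} → P a → P b → R a b → S a b) →
                      ∀ {T} → All P T → Linked R T → Linked S T
  linked-mapWithAll f _                []        = []
  linked-mapWithAll f _                [-]       = [-]
  linked-mapWithAll f (pa ∷ pb ∷ ps) (r ∷ rs) =
    f pa pb r ∷ linked-mapWithAll f (pb ∷ ps) rs

  IsNTableau′ : Tab n → Set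
  IsNTableau′ T = All NonEmpty T × All Sorted T × Linked Covers T

  IsNTableau⇒IsNTableau′ : ∀ {T} → IsNTableau T → IsNTableau′ T
  IsNTableau⇒IsNTableau′ ((ne , _ , below) , sorted , ⊆-below) =
    ne , sorted ,
    linked-mapWithAll (λ _ sU (B , U⊆L) → below⇒covers sU B U⊆L)
                      sorted (Linked.zip (below , ⊆-below))

  IsNTableau′⇒IsNTableau : ∀ {T} → IsNTableau′ T → IsNTableau T
  IsNTableau′⇒IsNTableau (ne , sorted , covers) =
    (ne , All.map (Linked.map ℕ.<⇒≤) sorted , linked-mapWithAll covers⇒below sorted covers) ,
    sorted , Linked.map covers⇒⊆ covers

  head-covered-rowUnion : ∀ {x : Letter n} {L m} → Connected Covers (just L) m →
                          Connected Covers (just (rowUnion x L)) m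
  head-covered-rowUnion (just cov)   = just (covers-rowUnion cov)
  head-covered-rowUnion just-nothing = just-nothing

  head-NInsert-covered : ∀ {L L′ : Row n} y rs →
                         (∀ {U} → Covers L U → Covers L′ (rowUnion y U)) →
                         Connected Covers (just L) (List.head rs) →
                         Connected Covers (just L′) (List.head (NInsert y rs))
  head-NInsert-covered y []       f just-nothing = just (f {[]} λ ())
  head-NInsert-covered y (r ∷ rs) f (just cov) with bumped y r
  ... | nothing = just (f cov)
  ... | just _  = just (f cov)

  NInsert-preserves : ∀ x T → IsNTableau′ T → IsNTableau′ (NInsert x T)
  NInsert-preserves x [] _ = tt ∷ [] , [-] ∷ [] , [-]
  NInsert-preserves x (r ∷ rs) (_ ∷ ne , s ∷ ss , covers) with bumped x r in eq
  ... | nothing =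
    rowUnion-nonEmpty r ∷ ne , rowUnion-sorted r s ∷ ss ,
    head-covered-rowUnion (Linked.head′ covers) ∷′ Linked.tail covers
  ... | just y with NInsert-preserves y rs (ne , ss , Linked.tail covers)
  ...   | ne′ , ss′ , covers′ =
    rowUnion-nonEmpty r ∷ ne′ , rowUnion-sorted r s ∷ ss′ ,
    head-NInsert-covered y rs (λ cov → covers-bumped cov eq) (Linked.head′ covers) ∷′ covers′

proposition6p1 : (n : ℕ) (T : Tab n) (x : Letter n) →
    IsNTableau T → IsNTableau (NInsert x T)
proposition6p1 n T x =
  IsNTableau′⇒IsNTableau ∘ NInsert-preserves x T ∘ IsNTableau⇒IsNTableau′
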